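{- Let $\mathbb{F}$ be a field and $n\geq 2$. If $f\in\mathbb{F}[x_1,\dots,x_n]$ is a polynomial such that $$\mathcal{Z}(f)\cap\{0,1\}^n=\big\{x\in\{0,1\}^n:\ x_1=0\ \text{and}\ \exists\, i>1\ \text{with}\ x_i=1\big\}\cup\{(1,\dots,1)\},$$ then $\deg(f)\geq n-1$.
   Context: $\mathcal{Z}(f)=\{a\in\mathbb{F}^n:f(a)=0\}$; $\{0,1\}^n$ denotes the points of $\mathbb{F}^n$ all of whose coordinates are $0$ or $1$. -}

module Defs where

open import Level using (Level; _⊔_; suc)
open import Algebra.Bundles using (CommutativeRing)
open import Data.Nat using (ℕ; zero; _<_; _≟_)
open import Data.Nat as ℕ using ()
open import Data.Fin using (Fin; toℕ)
open import Data.Bool using (Bool; true; false; if_then_else_)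
open import Data.List using (List; []; _∷_)
open import Data.Vec using (Vec; []; _∷_)
import Data.Vec.Properties as VecP
open import Data.Product using (Σ; ∃; _×_; _,_)
open import Data.Sum using (_⊎_)
open import Relation.Nullary using (¬_; yes; no)
open import Relation.Binary.PropositionalEquality using (_≡_)

record Field (c ℓ : Level) : Set (Level.suc (c ⊔ ℓ)) where
  field
    commutativeRing : CommutativeRing c ℓ
  open CommutativeRing commutativeRing public
  field
    1≉0     : ¬ (1# ≈ 0#)
    inverse : ∀ x → ¬ (x ≈ 0#) → Σ Carrier λ y → x * y ≈ 1#

-- Exponent vectors of monomials x^α = x_1^{α_1} ⋯ x_n^{α_n}
Monomial : ℕ → Set
Monomial n = Vec ℕ n

totalDegree : ∀ {n} → Monomial n → ℕ
totalDegree []       = 0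
totalDegree (a ∷ as) = a ℕ.+ totalDegree as

module _ {c ℓ} (F : Field c ℓ) where
  open Field F

  -- A polynomial in F[x_1,…,x_n], presented as a finite formal sum of
  -- terms c·x^α (repetitions allowed; two presentations denote the same
  -- polynomial iff they have the same coefficients, see `coeff`).
  Poly : ℕ → Set c
  Poly n = List (Carrier × Monomial n)

  coeff : ∀ {n} → Poly n → Monomial n → Carrier
  coeff []              α = 0#
  coeff ((a , β) ∷ f) α with VecP.≡-dec _≟_ β α
  ... | yes _ = a + coeff f α
  ... | no  _ = coeff f α

  DegreeAtMost : ∀ {n} → Poly n → ℕ → Set ℓ
  DegreeAtMost f d = ∀ α → d < totalDegree α → coeff f α ≈ 0#

  pow : Carrier → ℕ → Carrier
  pow x zero        = 1#
  pow x (ℕ.suc k)   = x * pow x k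

  evalMono : ∀ {n} → Monomial n → Vec Carrier n → Carrier
  evalMono []       []       = 1#
  evalMono (k ∷ ks) (x ∷ xs) = pow x k * evalMono ks xs

  eval : ∀ {n} → Poly n → Vec Carrier n → Carrier
  eval []              x = 0#
  eval ((a , β) ∷ f) x = a * evalMono β x + eval f x

  boolPoint : ∀ {n} → Vec Bool n → Vec Carrier n
  boolPoint = Data.Vec.map (λ b → if b then 1# else 0#)

-- The prescribed subset of {0,1}^n (coordinates indexed 0,…,n-1, so x_1 is
-- index 0):  { x : x_1 = 0 and ∃ i > 1, x_i = 1 } ∪ { (1,…,1) }
TargetSet : ∀ {n} → Vec Bool n → Set
TargetSet {n} x =
  ((∀ (i : Fin n) → toℕ i ≡ 0 → Data.Vec.lookup x i ≡ false)
     × ∃ λ (i : Fin n) → (0 < toℕ i) × (Data.Vec.lookup x i ≡ true))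
  ⊎ (∀ (i : Fin n) → Data.Vec.lookup x i ≡ true)

-- Restrict f to the face x₁ = 0 of the cube, giving h : {0,1}^(n-1) → 𝔽.
-- By hypothesis h vanishes everywhere except at the origin, so the
-- alternating sum Σ_y (-1)^{|y|} h(y) equals h(0) ≠ 0.  On the other hand
-- this alternating sum is linear in f and kills every monomial that misses
-- one of the n-1 free variables; if deg f < n-1 then every monomial of f
-- misses one, so the alternating sum would be 0.
module Submission where

open import Defs
open import Data.Nat using (ℕ; _≤_; _∸_)
open import Data.Vec using (Vec)
open import Data.Bool using (Bool)
open import Function.Bundles using (_⇔_)

open import Algebra.Bundles using (Ring)
open import Data.Bool using (true; false)
open import Data.Empty using (⊥-elim)
open import Data.Fin using (Fin) renaming (zero to fzero; suc to fsuc)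
open import Data.List using ([]; _∷_; length)
open import Data.Nat using (zero; suc; z≤n; s≤s; _<_; _<?_; _≤?_)
open import Data.Nat.Properties using (≤-refl; ≤-trans; ≤-<-trans; m≤n⇒m≤1+n; m≤n+m; ≰⇒>; ≮⇒≥)
open import Data.Product using (Σ; _,_; proj₁; proj₂)
open import Data.Sum using (_⊎_; inj₁; inj₂)
open import Data.Vec using ([]; _∷_; replicate; lookup; _[_]≔_)
import Data.Vec.Properties as VecP
open import Function.Bundles using (module Equivalence)
open import Relation.Nullary using (¬_; yes; no)
open import Relation.Binary.PropositionalEquality as ≡ using (_≡_)

module AlternatingSum {r ℓ} (R : Ring r ℓ) where
  open Ring R
  open import Algebra.Properties.Ring R using (-0#≈0#; -‿+-comm; x[y-z]≈xy-xz)
  open import Algebra.Properties.CommutativeSemigroup +-commutativeSemigroup using (interchange)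
  open import Relation.Binary.Reasoning.Setoid setoid

  alternatingSum : ∀ m → (Vec Bool m → Carrier) → Carrier
  alternatingSum zero    h = h []
  alternatingSum (suc m) h =
    alternatingSum m (λ y → h (false ∷ y)) - alternatingSum m (λ y → h (true ∷ y))

  alternatingSum-cong : ∀ m {g h : Vec Bool m → Carrier} → (∀ y → g y ≈ h y) →
    alternatingSum m g ≈ alternatingSum m h
  alternatingSum-cong zero    g≈h = g≈h []
  alternatingSum-cong (suc m) g≈h =
    +-cong (alternatingSum-cong m (λ y → g≈h (false ∷ y)))
           (-‿cong (alternatingSum-cong m (λ y → g≈h (true ∷ y))))

  alternatingSum-+ : ∀ m (g h : Vec Bool m → Carrier) →
    alternatingSum m (λ y → g y + h y) ≈ alternatingSum m g + alternatingSum m h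
  alternatingSum-+ zero    g h = refl
  alternatingSum-+ (suc m) g h = begin
    alternatingSum m (λ y → g (false ∷ y) + h (false ∷ y))
      - alternatingSum m (λ y → g (true ∷ y) + h (true ∷ y))
      ≈⟨ +-cong (alternatingSum-+ m _ _) (-‿cong (alternatingSum-+ m _ _)) ⟩
    (g₀ + h₀) - (g₁ + h₁)     ≈⟨ +-congˡ (sym (-‿+-comm g₁ h₁)) ⟩
    (g₀ + h₀) + (- g₁ + - h₁) ≈⟨ interchange g₀ h₀ (- g₁) (- h₁) ⟩
    (g₀ - g₁) + (h₀ - h₁)     ∎
    where
    g₀ = alternatingSum m (λ y → g (false ∷ y))
    g₁ = alternatingSum m (λ y → g (true ∷ y))
    h₀ = alternatingSum m (λ y → h (false ∷ y))
    h₁ = alternatingSum m (λ y → h (true ∷ y))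

  alternatingSum-*ˡ : ∀ m a (h : Vec Bool m → Carrier) →
    alternatingSum m (λ y → a * h y) ≈ a * alternatingSum m h
  alternatingSum-*ˡ zero    a h = refl
  alternatingSum-*ˡ (suc m) a h =
    trans (+-cong (alternatingSum-*ˡ m a _) (-‿cong (alternatingSum-*ˡ m a _)))
          (sym (x[y-z]≈xy-xz a _ _))

  alternatingSum-0 : ∀ m (h : Vec Bool m → Carrier) → (∀ y → h y ≈ 0#) →
    alternatingSum m h ≈ 0#
  alternatingSum-0 zero    h h≈0 = h≈0 []
  alternatingSum-0 (suc m) h h≈0 =
    trans (+-cong (alternatingSum-0 m _ (λ y → h≈0 (false ∷ y)))
                  (-‿cong (alternatingSum-0 m _ (λ y → h≈0 (true ∷ y)))))
          (-‿inverseʳ 0#)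

  alternatingSum-supportedAtOrigin : ∀ m (h : Vec Bool m → Carrier) →
    (∀ y → Σ (Fin m) (λ j → lookup y j ≡ true) → h y ≈ 0#) →
    alternatingSum m h ≈ h (replicate m false)
  alternatingSum-supportedAtOrigin zero    h h≈0 = refl
  alternatingSum-supportedAtOrigin (suc m) h h≈0 = begin
    alternatingSum m (λ y → h (false ∷ y)) - alternatingSum m (λ y → h (true ∷ y))
      ≈⟨ +-cong (alternatingSum-supportedAtOrigin m _ (λ y (j , yⱼ) → h≈0 (false ∷ y) (fsuc j , yⱼ)))
                (-‿cong (alternatingSum-0 m _ (λ y → h≈0 (true ∷ y) (fzero , ≡.refl)))) ⟩
    h (replicate (suc m) false) - 0# ≈⟨ +-congˡ -0#≈0# ⟩
    h (replicate (suc m) false) + 0# ≈⟨ +-identityʳ _ ⟩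
    h (replicate (suc m) false)      ∎

  alternatingSum-independent : ∀ m (h : Vec Bool m → Carrier) (j : Fin m) →
    (∀ y → h (y [ j ]≔ false) ≈ h (y [ j ]≔ true)) → alternatingSum m h ≈ 0#
  alternatingSum-independent (suc m) h fzero h-indep =
    trans (+-congˡ (-‿cong (alternatingSum-cong m (λ y → sym (h-indep (false ∷ y))))))
          (-‿inverseʳ _)
  alternatingSum-independent (suc m) h (fsuc j) h-indep =
    trans (+-cong (alternatingSum-independent m _ j (λ y → h-indep (false ∷ y)))
                  (-‿cong (alternatingSum-independent m _ j (λ y → h-indep (true ∷ y)))))
          (-‿inverseʳ 0#)

small-degree⇒missing-variable : ∀ {m} (β : Monomial m) → totalDegree β < m →
  Σ (Fin m) λ j → lookup β j ≡ 0
small-degree⇒missing-variable (zero  ∷ β) _ = fzero , ≡.refl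
small-degree⇒missing-variable (suc k ∷ β) (s≤s |β|<m)
  with j , βⱼ≡0 ← small-degree⇒missing-variable β (≤-trans (s≤s (m≤n+m _ k)) |β|<m)
  = fsuc j , βⱼ≡0

module Polynomials {c ℓ} (F : Field c ℓ) where
  open Field F
  open AlternatingSum ring
  open import Relation.Binary.Reasoning.Setoid setoid

  evalMono-boolPoint-independent : ∀ {n} (β : Monomial n) (j : Fin n) → lookup β j ≡ 0 →
    ∀ (y : Vec Bool n) a b →
    evalMono F β (boolPoint F (y [ j ]≔ a)) ≈ evalMono F β (boolPoint F (y [ j ]≔ b))
  evalMono-boolPoint-independent (.0 ∷ β) fzero ≡.refl (_ ∷ y) a b = refl
  evalMono-boolPoint-independent (k ∷ β) (fsuc j) βⱼ≡0 (_ ∷ y) a b =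
    *-congˡ (evalMono-boolPoint-independent β j βⱼ≡0 y a b)

  module _ {n : ℕ} where

    dropMonomial : Monomial n → Poly F n → Poly F n
    dropMonomial β [] = []
    dropMonomial β ((a , β′) ∷ f) with VecP.≡-dec Data.Nat._≟_ β′ β
    ... | yes _ = dropMonomial β f
    ... | no  _ = (a , β′) ∷ dropMonomial β f

    length-dropMonomial : ∀ β f → length (dropMonomial β f) ≤ length f
    length-dropMonomial β [] = z≤n
    length-dropMonomial β ((a , β′) ∷ f) with VecP.≡-dec Data.Nat._≟_ β′ β
    ... | yes _ = m≤n⇒m≤1+n (length-dropMonomial β f)
    ... | no  _ = s≤s (length-dropMonomial β f)

    length-dropMonomial-head : ∀ a β f → length (dropMonomial β ((a , β) ∷ f)) ≤ length f
    length-dropMonomial-head a β f with VecP.≡-dec Data.Nat._≟_ β β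
    ... | yes _  = length-dropMonomial β f
    ... | no β≢β = ⊥-elim (β≢β ≡.refl)

    coeff-dropMonomial-same : ∀ β f → coeff F (dropMonomial β f) β ≈ 0#
    coeff-dropMonomial-same β [] = refl
    coeff-dropMonomial-same β ((a , β′) ∷ f) with VecP.≡-dec Data.Nat._≟_ β′ β
    ... | yes _ = coeff-dropMonomial-same β f
    ... | no β′≢β with VecP.≡-dec Data.Nat._≟_ β′ β
    ...   | yes β′≡β = ⊥-elim (β′≢β β′≡β)
    ...   | no  _    = coeff-dropMonomial-same β f

    coeff-dropMonomial-other : ∀ β α f → ¬ (β ≡ α) → coeff F (dropMonomial β f) α ≈ coeff F f α
    coeff-dropMonomial-other β α [] _ = refl
    coeff-dropMonomial-other β α ((a , β′) ∷ f) β≢α with VecP.≡-dec Data.Nat._≟_ β′ β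
    ... | yes ≡.refl with VecP.≡-dec Data.Nat._≟_ β′ α
    ...   | yes β≡α = ⊥-elim (β≢α β≡α)
    ...   | no  _   = coeff-dropMonomial-other β α f β≢α
    coeff-dropMonomial-other β α ((a , β′) ∷ f) β≢α | no _ with VecP.≡-dec Data.Nat._≟_ β′ α
    ...   | yes _ = +-congˡ (coeff-dropMonomial-other β α f β≢α)
    ...   | no  _ = coeff-dropMonomial-other β α f β≢α

  module _ {n} (φ : Monomial n → Carrier) where

    linearExtension : Poly F n → Carrier
    linearExtension []            = 0#
    linearExtension ((a , β) ∷ f) = a * φ β + linearExtension f

    linearExtension-split : ∀ β f →
      linearExtension f ≈ coeff F f β * φ β + linearExtension (dropMonomial β f)
    linearExtension-split β [] = sym (trans (+-identityʳ _) (zeroˡ _))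
    linearExtension-split β ((a , β′) ∷ f) with VecP.≡-dec Data.Nat._≟_ β′ β
    ... | yes ≡.refl = begin
      a * φ β + linearExtension f
        ≈⟨ +-congˡ (linearExtension-split β f) ⟩
      a * φ β + (coeff F f β * φ β + rest) ≈⟨ sym (+-assoc _ _ _) ⟩
      (a * φ β + coeff F f β * φ β) + rest ≈⟨ +-congʳ (sym (distribʳ _ _ _)) ⟩
      (a + coeff F f β) * φ β + rest       ∎
      where rest = linearExtension (dropMonomial β f)
    ... | no _ = begin
      a * φ β′ + linearExtension f
        ≈⟨ +-congˡ (linearExtension-split β f) ⟩
      a * φ β′ + (coeff F f β * φ β + rest) ≈⟨ sym (+-assoc _ _ _) ⟩
      (a * φ β′ + coeff F f β * φ β) + rest ≈⟨ +-congʳ (+-comm _ _) ⟩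
      (coeff F f β * φ β + a * φ β′) + rest ≈⟨ +-assoc _ _ _ ⟩
      coeff F f β * φ β + (a * φ β′ + rest) ∎
      where rest = linearExtension (dropMonomial β f)

    -- A presentation may repeat a monomial with cancelling coefficients, so the
    -- terms are grouped by monomial with `dropMonomial`; k is recursion fuel.
    linearExtension-vanishes : ∀ k f → length f ≤ k →
      (∀ α → coeff F f α ≈ 0# ⊎ φ α ≈ 0#) → linearExtension f ≈ 0#
    linearExtension-vanishes k [] _ _ = refl
    linearExtension-vanishes (suc k) g@((a , β) ∷ f) (s≤s |f|≤k) g⊥φ = begin
      linearExtension g
        ≈⟨ linearExtension-split β g ⟩
      coeff F g β * φ β + linearExtension (dropMonomial β g)
        ≈⟨ +-cong head≈0 (linearExtension-vanishes k (dropMonomial β g)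
                 (≤-trans (length-dropMonomial-head a β f) |f|≤k) rest⊥φ) ⟩
      0# + 0# ≈⟨ +-identityʳ _ ⟩
      0#      ∎
      where
      head≈0 : coeff F g β * φ β ≈ 0#
      head≈0 with g⊥φ β
      ... | inj₁ gβ≈0 = trans (*-congʳ gβ≈0) (zeroˡ _)
      ... | inj₂ φβ≈0 = trans (*-congˡ φβ≈0) (zeroʳ _)
      rest⊥φ : ∀ α → coeff F (dropMonomial β g) α ≈ 0# ⊎ φ α ≈ 0#
      rest⊥φ α with VecP.≡-dec Data.Nat._≟_ β α
      ... | yes ≡.refl = inj₁ (coeff-dropMonomial-same β g)
      ... | no  β≢α with g⊥φ α
      ...   | inj₁ gα≈0 = inj₁ (trans (coeff-dropMonomial-other β α g β≢α) gα≈0)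
      ...   | inj₂ φα≈0 = inj₂ φα≈0

  alternatingSum-eval : ∀ m {n} (P : Vec Bool m → Vec Carrier n) (f : Poly F n) →
    alternatingSum m (λ y → eval F f (P y))
      ≈ linearExtension (λ β → alternatingSum m (λ y → evalMono F β (P y))) f
  alternatingSum-eval m P [] = alternatingSum-0 m _ (λ _ → refl)
  alternatingSum-eval m P ((a , β) ∷ f) =
    trans (alternatingSum-+ m _ _) (+-cong (alternatingSum-*ˡ m a _) (alternatingSum-eval m P f))

  zeroSet≡target⇒m≤degree : ∀ m (f : Poly F (suc m)) →
    (∀ x → (eval F f (boolPoint F x) ≈ 0#) ⇔ TargetSet x) →
    ∀ d → DegreeAtMost F f d → m ≤ d
  zeroSet≡target⇒m≤degree m f zeros d deg≤d with m ≤? d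
  ... | yes m≤d = m≤d
  ... | no  m≰d = ⊥-elim (h0≉0 (trans (sym Σh≈h0) Σh≈0))
    where
    h : Vec Bool m → Carrier
    h y = eval F f (boolPoint F (false ∷ y))

    Σh≈h0 : alternatingSum m h ≈ h (replicate m false)
    Σh≈h0 = alternatingSum-supportedAtOrigin m h λ y (j , yⱼ) →
      Equivalence.from (zeros (false ∷ y))
        (inj₁ ((λ { fzero _ → ≡.refl ; (fsuc _) () }) , fsuc j , s≤s z≤n , yⱼ))

    h0≉0 : ¬ (h (replicate m false) ≈ 0#)
    h0≉0 h0≈0 with Equivalence.to (zeros (false ∷ replicate m false)) h0≈0
    ... | inj₁ (_ , fsuc j , _ , 0ⱼ≡true) with ≡.trans (≡.sym (VecP.lookup-replicate j false)) 0ⱼ≡true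
    ...   | ()
    h0≉0 h0≈0 | inj₂ all-true with all-true fzero
    ... | ()

    φ : Monomial (suc m) → Carrier
    φ β = alternatingSum m (λ y → evalMono F β (boolPoint F (false ∷ y)))

    f⊥φ : ∀ α → coeff F f α ≈ 0# ⊎ φ α ≈ 0#
    f⊥φ α@(b ∷ β) with d <? totalDegree α
    ... | yes d<|α| = inj₁ (deg≤d α d<|α|)
    ... | no  d≮|α| = inj₂ (alternatingSum-independent m _ j λ y →
            evalMono-boolPoint-independent α (fsuc j) βⱼ≡0 (false ∷ y) false true)
      where
      |β|<m : totalDegree β < m
      |β|<m = ≤-<-trans (m≤n+m _ b) (≤-<-trans (≮⇒≥ d≮|α|) (≰⇒> m≰d))
      j = proj₁ (small-degree⇒missing-variable β |β|<m)
      βⱼ≡0 = proj₂ (small-degree⇒missing-variable β |β|<m)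

    Σh≈0 : alternatingSum m h ≈ 0#
    Σh≈0 = trans (alternatingSum-eval m (λ y → boolPoint F (false ∷ y)) f)
                 (linearExtension-vanishes φ (length f) f ≤-refl f⊥φ)

corollary5p4 : ∀ {c ℓ} (F : Field c ℓ) (n : ℕ) → 2 ≤ n → (f : Poly F n) →
    (∀ (x : Vec Bool n) → (Field._≈_ F (eval F f (boolPoint F x)) (Field.0# F) ⇔ TargetSet x)) →
    ∀ (d : ℕ) → DegreeAtMost F f d → n ∸ 1 ≤ d
corollary5p4 F (suc m) _ f zeros d deg≤d = Polynomials.zeroSet≡target⇒m≤degree F m f zeros d deg≤d
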